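{- For all natural numbers $n > m \geq 0$, \[ b_{n,m} = b_{n,m-1} + \sum_{k=1}^{n-m-1} b_{n-k,m-1} \binom{b_{m,m-1}}{k} + \binom{b_{m,m-1}}{n-m} \sum_{k=0}^m b_{k,k-1}, \] where $b_{0,-1} = 1$ and $b_{n,-1} = 0$ for all $n \geq 1$, and where $\binom{a}{b} = 0$ if $a < b$.
   Context: The adjunctive hierarchy of hereditarily finite sets is defined by $A_0 := \{\emptyset\}$ and $A_{n+1} := \{\emptyset\} \cup \{ x \cup \{y\} : x, y \in A_n\}$, with the convention $A_n := \emptyset$ for integers $n < 0$. For all integers $n, m$, let $B_{n,m} := \{ x \in A_n \setminus A_{n-1} : x \subseteq A_m\}$ and $b_{n,m} := |B_{n,m}|$. (Thus $|A_n| = \sum_{k=0}^n b_{k,k-1}$.) -}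

module Defs where

-- Hereditarily finite sets are represented by their Ackermann codes:
-- a natural number x codes the set { y : bit y of x is 1 }, where each y
-- is itself a code.  This is a bijection ℕ ≅ HF, so equality of codes is
-- extensional equality of sets (and ∅ has code 0).

open import Data.Nat using (ℕ; zero; suc; _+_; _^_; _/_; _%_; _≟_)
open import Data.Integer using (ℤ; +_; -[1+_])
open import Data.List using (List; []; _∷_; concatMap; map; deduplicate; filter; length)
open import Data.List.Membership.DecPropositional _≟_ using (_∈_; _∈?_)
open import Data.Product using (_×_; _,_; proj₁)
open import Data.Unit using (⊤; tt)
open import Data.Empty using (⊥-elim)
open import Data.Bool using (if_then_else_)
open import Relation.Nullary using (Dec; yes; no; ¬?; _×-dec_)
open import Relation.Nullary.Decidable using (does)
open import Relation.Binary.PropositionalEquality using (_≡_)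
open import Function using (_∘_)

bit : ℕ → ℕ → ℕ
bit zero x = x % 2
bit (suc y) x = bit y (x / 2)

_∈ₕ_ : ℕ → ℕ → Set
y ∈ₕ x = bit y x ≡ 1

_∈ₕ?_ : (y x : ℕ) → Dec (y ∈ₕ x)
y ∈ₕ? x = bit y x ≟ 1

∅ₕ : ℕ
∅ₕ = 0

adj : ℕ → ℕ → ℕ
adj x y = if does (y ∈ₕ? x) then x else x + 2 ^ y

AllBelow : ℕ → ℕ → List ℕ → Set
AllBelow zero x S = ⊤
AllBelow (suc k) x S = AllBelow k x S × (k ∈ₕ x → k ∈ S)

AllBelow? : (k x : ℕ) (S : List ℕ) → Dec (AllBelow k x S)
AllBelow? zero x S = yes tt
AllBelow? (suc k) x S with AllBelow? k x S | k ∈ₕ? x | k ∈? S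
... | no p | _ | _ = no (p ∘ proj₁)
... | yes p | no q | _ = yes (p , λ r → ⊥-elim (q r))
... | yes p | yes q | yes s = yes (p , λ _ → s)
... | yes p | yes q | no s = no (λ { (_ , f) → s (f q) })

-- x ⊆ S (S a finite set given as a list).  Every element y of the set
-- coded by x satisfies y < x (since 2^y > y), so it suffices to check y < x.
_⊆ₕ?_ : (x : ℕ) (S : List ℕ) → Dec (AllBelow x x S)
x ⊆ₕ? S = AllBelow? x x S

A′ : ℕ → List ℕ
A′ zero = ∅ₕ ∷ []
A′ (suc n) = deduplicate _≟_ (∅ₕ ∷ concatMap (λ x → map (adj x) (A′ n)) (A′ n))

A : ℤ → List ℕ
A (+ n) = A′ n
A -[1+ n ] = []

pred : ℤ → ℤ
pred (+ zero) = -[1+ 0 ]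
pred (+ suc n) = + n
pred -[1+ n ] = -[1+ suc n ]

B : ℤ → ℤ → List ℕ
B n m = filter (λ x → ¬? (x ∈? A (pred n)) ×-dec (x ⊆ₕ? A m)) (A n)

-- b_{n,m} = |B_{n,m}|   (A n is duplicate-free, hence so is B n m)
b : ℤ → ℤ → ℕ
b n m = length (B n m)

module Submission where

-- Fix m and split A_m into U = A_{m-1} and L = B_{m,m-1}, the sets that first
-- appear at level m.  The subsets of A_m are enumerated by adjoining the
-- elements of L one at a time to the subsets of U.  The key structural fact is
-- a level shift: for l ∈ L, z ⊆ A_m and l ∉ z,
--     z ∪ {l} ∈ A_j   iff   j = j' + 1,  m ≤ j'  and  z ∈ A_j'.
-- So adjoining l moves every subset of K ∪ U one level up, and the |A_m|
-- subsets lying in A_m all land exactly at level m + 1.  Hence the number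
-- N(K, m+1+r) of subsets of K ∪ U at exact level m+1+r satisfies a Pascal
-- recurrence in (|K|, r), whose solution is the closed form of the theorem;
-- finally |A_m| = Σ_{k ≤ m} b_{k,k-1}.

open import Defs
open import Data.Nat using (ℕ; zero; suc; _∸_; _<_; _≤_; _+_; _*_; _^_; _/_; _%_; z≤n; s≤s; _≟_; _<?_)
open import Data.Nat.Properties
open import Data.Nat.DivMod using (m≡m%n+[m/n]*n; m%n<n; [m+kn]%n≡m%n; m<n⇒m%n≡m; +-distrib-/-∣ʳ; m<n⇒m/n≡0; m*n/n≡m; m/n<m)
open import Data.Nat.Divisibility using (divides-refl)
open import Data.Nat.Combinatorics using (_C_; nC1≡n; nCk+nC[k+1]≡[n+1]C[k+1])
open import Data.Nat.ListAction using (sum)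
open import Data.Nat.ListAction.Properties using (sum-++)
open import Data.Nat.Solver using (module +-*-Solver)
open import Data.Integer using (+_)
open import Data.List using (List; []; _∷_; [_]; map; filter; length; _++_; concatMap; upTo; applyUpTo)
open import Data.List.Properties using (map-applyUpTo; applyUpTo-∷ʳ; filter-++; length-++)
open import Data.List.Membership.Propositional using (_∈_; find; lose)
open import Data.List.Membership.DecPropositional _≟_ using (_∈?_)
open import Data.List.Membership.Propositional.Properties
  using (∈-deduplicate⁻; ∈-deduplicate⁺; ∈-concatMap⁻; ∈-concatMap⁺; ∈-map⁻; ∈-map⁺; ∈-++⁻; ∈-++⁺ˡ; ∈-++⁺ʳ; ∈-filter⁻; ∈-filter⁺)
open import Data.List.Membership.Propositional.Properties.WithK using (unique∧set⇒bag)
open import Data.List.Relation.Binary.BagAndSetEquality using (∼bag⇒↭)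
open import Data.List.Relation.Binary.Permutation.Propositional.Properties using (↭-length)
open import Data.List.Relation.Unary.Any using (here; there; tail)
open import Data.List.Relation.Unary.All using ([])
open import Data.List.Relation.Unary.All.Properties using (All¬⇒¬Any)
open import Data.List.Relation.Unary.AllPairs using ([]; _∷_) renaming (tail to unique-tail)
open import Data.List.Relation.Unary.Unique.Propositional using (Unique)
import Data.List.Relation.Unary.Unique.Propositional.Properties as Unique
open import Data.List.Relation.Unary.Unique.DecPropositional.Properties _≟_ using (deduplicate-!)
open import Data.Sum using (_⊎_; inj₁; inj₂)
open import Data.Product using (Σ; _×_; _,_; proj₁; proj₂)
open import Data.Empty using (⊥-elim)
open import Data.Unit using (tt)
open import Function using (_∘_; id; mk⇔)
open import Level using (0ℓ)
open import Relation.Nullary using (¬_; yes; no; ¬?; _×-dec_)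
open import Relation.Unary using (Pred; Decidable)
open import Relation.Binary.PropositionalEquality using (_≡_; _≢_; refl; sym; trans; cong; cong₂; subst; module ≡-Reasoning)

-- Binary digits of a code

low-digit : ∀ r q → r < 2 → (r + q * 2) % 2 ≡ r
low-digit r q r<2 = trans ([m+kn]%n≡m%n r q 2) (m<n⇒m%n≡m r<2)

half-digit : ∀ r q → r < 2 → (r + q * 2) / 2 ≡ q
half-digit r q r<2 =
  trans (+-distrib-/-∣ʳ r {q * 2} {2} (divides-refl q)) (cong₂ _+_ (m<n⇒m/n≡0 r<2) (m*n/n≡m q 2))

digits : ∀ x → x ≡ x % 2 + x / 2 * 2
digits x = m≡m%n+[m/n]*n x 2

bit-binary : ∀ y x → bit y x ≡ 0 ⊎ bit y x ≡ 1
bit-binary zero x with x % 2 | m%n<n x 2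
... | 0 | _ = inj₁ refl
... | 1 | _ = inj₂ refl
... | suc (suc _) | s≤s (s≤s ())
bit-binary (suc y) x = bit-binary y (x / 2)

bit-of-zero : ∀ y → bit y 0 ≡ 0
bit-of-zero zero = refl
bit-of-zero (suc y) = bit-of-zero y

add-double-power : ∀ x y → x + 2 ^ suc y ≡ x % 2 + (x / 2 + 2 ^ y) * 2
add-double-power x y = begin
  x + 2 ^ suc y                   ≡⟨ cong₂ _+_ (digits x) (*-comm 2 (2 ^ y)) ⟩
  x % 2 + x / 2 * 2 + 2 ^ y * 2   ≡⟨ +-assoc (x % 2) _ _ ⟩
  x % 2 + (x / 2 * 2 + 2 ^ y * 2) ≡⟨ cong (λ t → x % 2 + t) (*-distribʳ-+ 2 (x / 2) (2 ^ y)) ⟨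
  x % 2 + (x / 2 + 2 ^ y) * 2     ∎
  where open ≡-Reasoning

low-add-double-power : ∀ x y → (x + 2 ^ suc y) % 2 ≡ x % 2
low-add-double-power x y =
  trans (cong (_% 2) (add-double-power x y)) (low-digit (x % 2) (x / 2 + 2 ^ y) (m%n<n x 2))

half-add-double-power : ∀ x y → (x + 2 ^ suc y) / 2 ≡ x / 2 + 2 ^ y
half-add-double-power x y =
  trans (cong (_/ 2) (add-double-power x y)) (half-digit (x % 2) (x / 2 + 2 ^ y) (m%n<n x 2))

succ-of-even : ∀ x → x % 2 ≡ 0 → x + 1 ≡ 1 + x / 2 * 2
succ-of-even x even = begin
  x + 1                   ≡⟨ +-comm x 1 ⟩
  1 + x                   ≡⟨ cong (λ t → 1 + t) (digits x) ⟩
  1 + (x % 2 + x / 2 * 2) ≡⟨ cong (λ r → 1 + (r + x / 2 * 2)) even ⟩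
  1 + x / 2 * 2           ∎
  where open ≡-Reasoning

low-succ-of-even : ∀ x → x % 2 ≡ 0 → (x + 1) % 2 ≡ 1
low-succ-of-even x even = trans (cong (_% 2) (succ-of-even x even)) (low-digit 1 (x / 2) (s≤s (s≤s z≤n)))

half-succ-of-even : ∀ x → x % 2 ≡ 0 → (x + 1) / 2 ≡ x / 2
half-succ-of-even x even = trans (cong (_/ 2) (succ-of-even x even)) (half-digit 1 (x / 2) (s≤s (s≤s z≤n)))

bit-set-here : ∀ y x → bit y x ≡ 0 → bit y (x + 2 ^ y) ≡ 1
bit-set-here zero x clear = low-succ-of-even x clear
bit-set-here (suc y) x clear =
  trans (cong (bit y) (half-add-double-power x y)) (bit-set-here y (x / 2) clear)

bit-set-elsewhere : ∀ y x z → bit y x ≡ 0 → z ≢ y → bit z (x + 2 ^ y) ≡ bit z x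
bit-set-elsewhere zero x zero _ z≢y = ⊥-elim (z≢y refl)
bit-set-elsewhere zero x (suc z) clear _ = cong (bit z) (half-succ-of-even x clear)
bit-set-elsewhere (suc y) x zero _ _ = low-add-double-power x y
bit-set-elsewhere (suc y) x (suc z) clear z≢y =
  trans (cong (bit z) (half-add-double-power x y)) (bit-set-elsewhere y (x / 2) z clear (z≢y ∘ cong suc))

bits-ext-bounded : ∀ f x x' → x ≤ f → x' ≤ f → (∀ z → bit z x ≡ bit z x') → x ≡ x'
bits-ext-bounded zero zero zero _ _ _ = refl
bits-ext-bounded zero (suc _) _ () _ _
bits-ext-bounded zero zero (suc _) _ () _
bits-ext-bounded (suc f) x x' x≤ x'≤ same = begin
  x                   ≡⟨ digits x ⟩
  x % 2 + x / 2 * 2   ≡⟨ cong₂ (λ r q → r + q * 2) (same 0) halves-equal ⟩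
  x' % 2 + x' / 2 * 2 ≡⟨ digits x' ⟨
  x'                  ∎
  where
  open ≡-Reasoning
  half≤ : ∀ y → y ≤ suc f → y / 2 ≤ f
  half≤ zero _ = z≤n
  half≤ (suc y) y≤ = ≤-pred (≤-trans (m/n<m (suc y) 2 (s≤s (s≤s z≤n))) y≤)
  halves-equal : x / 2 ≡ x' / 2
  halves-equal = bits-ext-bounded f (x / 2) (x' / 2) (half≤ x x≤) (half≤ x' x'≤) (same ∘ suc)

bits-ext : ∀ x x' → (∀ z → bit z x ≡ bit z x') → x ≡ x'
bits-ext x x' = bits-ext-bounded (x + x') x x' (m≤m+n x x') (m≤n+m x' x)

-- A member y of x contributes 2^y to x, so members are smaller than their set;
-- this is why x ⊆ₕ? S only needs to inspect the candidates below x.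
member-power≤ : ∀ y x → y ∈ₕ x → 2 ^ y ≤ x
member-power≤ zero zero ()
member-power≤ zero (suc x) _ = s≤s z≤n
member-power≤ (suc y) x y∈x = begin
  2 ^ suc y         ≡⟨ *-comm 2 (2 ^ y) ⟩
  2 ^ y * 2         ≤⟨ *-monoˡ-≤ 2 (member-power≤ y (x / 2) y∈x) ⟩
  x / 2 * 2         ≤⟨ m≤n+m _ (x % 2) ⟩
  x % 2 + x / 2 * 2 ≡⟨ digits x ⟨
  x                 ∎
  where open ≤-Reasoning

n<2^n : ∀ n → n < 2 ^ n
n<2^n zero = s≤s z≤n
n<2^n (suc n) = begin-strict
  suc n         ≤⟨ n<2^n n ⟩
  2 ^ n         <⟨ m<m+n (2 ^ n) (m^n>0 2 n) ⟩
  2 ^ n + 2 ^ n ≡⟨ cong (λ t → 2 ^ n + t) (+-identityʳ (2 ^ n)) ⟨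
  2 ^ suc n     ∎
  where open ≤-Reasoning

member-< : ∀ y x → y ∈ₕ x → y < x
member-< y x y∈x = <-≤-trans (n<2^n y) (member-power≤ y x y∈x)

clear-bit : ∀ u x → u ∈ₕ x → Σ ℕ λ x' → bit u x' ≡ 0 × x ≡ x' + 2 ^ u
clear-bit zero x u∈x = x / 2 * 2 , low-digit 0 (x / 2) (s≤s z≤n) , x≡
  where
  x≡ : x ≡ x / 2 * 2 + 1
  x≡ = trans (digits x) (trans (cong (λ t → t + x / 2 * 2) u∈x) (+-comm 1 _))
clear-bit (suc u) x u∈x with clear-bit u (x / 2) u∈x
... | h , clear , half≡ = x % 2 + h * 2 , trans (cong (bit u) (half-digit (x % 2) h (m%n<n x 2))) clear , x≡
  where
  open ≡-Reasoning
  x≡ : x ≡ x % 2 + h * 2 + 2 ^ suc u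
  x≡ = begin
    x                                 ≡⟨ digits x ⟩
    x % 2 + x / 2 * 2                 ≡⟨ cong (λ t → x % 2 + t * 2) half≡ ⟩
    x % 2 + (h + 2 ^ u) * 2           ≡⟨ cong (λ t → x % 2 + t) (*-distribʳ-+ 2 h (2 ^ u)) ⟩
    x % 2 + (h * 2 + 2 ^ u * 2)       ≡⟨ +-assoc (x % 2) _ _ ⟨
    x % 2 + h * 2 + 2 ^ u * 2         ≡⟨ cong (λ t → x % 2 + h * 2 + t) (*-comm 2 (2 ^ u)) ⟨
    x % 2 + h * 2 + 2 ^ suc u         ∎

-- Codes of finite sets

Codes : ℕ → (ℕ → Set) → Set
Codes x P = ∀ q → (q ∈ₕ x → P q) × (P q → q ∈ₕ x)

codes-ext : ∀ {x x' P Q} → Codes x P → Codes x' Q → (∀ q → P q → Q q) → (∀ q → Q q → P q) → x ≡ x'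
codes-ext {x} {x'} cx cx' P⇒Q Q⇒P = bits-ext x x' same-bit
  where
  same-bit : ∀ z → bit z x ≡ bit z x'
  same-bit z with bit-binary z x | bit-binary z x'
  ... | inj₁ x₀ | inj₁ x'₀ = trans x₀ (sym x'₀)
  ... | inj₂ x₁ | _ = trans x₁ (sym (proj₂ (cx' z) (P⇒Q z (proj₁ (cx z) x₁))))
  ... | inj₁ x₀ | inj₂ x'₁ = ⊥-elim (0≢1+n (trans (sym x₀) (proj₂ (cx z) (Q⇒P z (proj₁ (cx' z) x'₁)))))

self-codes : ∀ x → Codes x (_∈ₕ x)
self-codes x q = id , id

clear⇒∉ : ∀ y x → bit y x ≡ 0 → ¬ y ∈ₕ x
clear⇒∉ y x clear y∈x = 0≢1+n (trans (sym clear) y∈x)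

∉⇒clear : ∀ y x → ¬ y ∈ₕ x → bit y x ≡ 0
∉⇒clear y x y∉x with bit-binary y x
... | inj₁ clear = clear
... | inj₂ set = ⊥-elim (y∉x set)

∉∅ : ∀ q → ¬ q ∈ₕ 0
∉∅ q = clear⇒∉ q 0 (bit-of-zero q)

no-members⇒∅ : ∀ {z} → (∀ q → ¬ q ∈ₕ z) → z ≡ 0
no-members⇒∅ {z} none =
  codes-ext (self-codes z) (self-codes 0) (λ q q∈z → ⊥-elim (none q q∈z)) (λ q q∈∅ → ⊥-elim (∉∅ q q∈∅))

insert-codes : ∀ x y → ¬ y ∈ₕ x → Codes (x + 2 ^ y) (λ q → q ∈ₕ x ⊎ q ≡ y)
insert-codes x y y∉x q = to , from
  where
  clear : bit y x ≡ 0
  clear = ∉⇒clear y x y∉x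
  to : q ∈ₕ (x + 2 ^ y) → q ∈ₕ x ⊎ q ≡ y
  to q∈ with q ≟ y
  ... | yes q≡y = inj₂ q≡y
  ... | no q≢y = inj₁ (trans (sym (bit-set-elsewhere y x q clear q≢y)) q∈)
  from : q ∈ₕ x ⊎ q ≡ y → q ∈ₕ (x + 2 ^ y)
  from (inj₂ refl) = bit-set-here y x clear
  from (inj₁ q∈x) with q ≟ y
  ... | yes refl = ⊥-elim (y∉x q∈x)
  ... | no q≢y = trans (bit-set-elsewhere y x q clear q≢y) q∈x

adj-member : ∀ x y → y ∈ₕ x → adj x y ≡ x
adj-member x y y∈x rewrite y∈x = refl

adj-fresh : ∀ x y → bit y x ≡ 0 → adj x y ≡ x + 2 ^ y
adj-fresh x y clear rewrite clear = refl

adj-codes : ∀ x y → Codes (adj x y) (λ q → q ∈ₕ x ⊎ q ≡ y)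
adj-codes x y with bit-binary y x
... | inj₁ clear = subst (λ a → Codes a (λ q → q ∈ₕ x ⊎ q ≡ y)) (sym (adj-fresh x y clear))
  (insert-codes x y (clear⇒∉ y x clear))
... | inj₂ y∈x = subst (λ a → Codes a (λ q → q ∈ₕ x ⊎ q ≡ y)) (sym (adj-member x y y∈x))
  λ q → inj₁ , λ { (inj₁ q∈x) → q∈x ; (inj₂ refl) → y∈x }

delete-codes : ∀ x l → Σ ℕ λ z → Codes z (λ q → q ∈ₕ x × q ≢ l)
delete-codes x l with l ∈ₕ? x
... | no l∉x = x , λ q → (λ q∈x → q∈x , λ { refl → l∉x q∈x }) , proj₁
... | yes l∈x with clear-bit l x l∈x
...   | z , clear , refl = z , λ q → to q , from q
  where
  z∪l : Codes (z + 2 ^ l) (λ q → q ∈ₕ z ⊎ q ≡ l)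
  z∪l = insert-codes z l (clear⇒∉ l z clear)
  to : ∀ q → q ∈ₕ z → q ∈ₕ (z + 2 ^ l) × q ≢ l
  to q q∈z = proj₂ (z∪l q) (inj₁ q∈z) , λ { refl → clear⇒∉ l z clear q∈z }
  from : ∀ q → q ∈ₕ (z + 2 ^ l) × q ≢ l → q ∈ₕ z
  from q (q∈ , q≢l) with proj₁ (z∪l q) q∈
  ... | inj₁ q∈z = q∈z
  ... | inj₂ q≡l = ⊥-elim (q≢l q≡l)

insert-then-delete : ∀ {w z l} → ¬ l ∈ₕ z → Codes w (λ q → q ∈ₕ z ⊎ q ≡ l) → Codes z (λ q → q ∈ₕ w × q ≢ l)
insert-then-delete {w} {z} {l} l∉z cw q = to , from
  where
  to : q ∈ₕ z → q ∈ₕ w × q ≢ l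
  to q∈z = proj₂ (cw q) (inj₁ q∈z) , λ { refl → l∉z q∈z }
  from : q ∈ₕ w × q ≢ l → q ∈ₕ z
  from (q∈w , q≢l) with proj₁ (cw q) q∈w
  ... | inj₁ q∈z = q∈z
  ... | inj₂ q≡l = ⊥-elim (q≢l q≡l)

delete-adjoined : ∀ {x x₀ l z d} → Codes x (λ q → q ∈ₕ x₀ ⊎ q ≡ l) →
  Codes z (λ q → q ∈ₕ x × q ≢ l) → Codes d (λ q → q ∈ₕ x₀ × q ≢ l) → z ≡ d
delete-adjoined {x} {x₀} {l} cx cz cd = codes-ext cz cd to from
  where
  to : ∀ q → q ∈ₕ x × q ≢ l → q ∈ₕ x₀ × q ≢ l
  to q (q∈x , q≢l) with proj₁ (cx q) q∈x
  ... | inj₁ q∈x₀ = q∈x₀ , q≢l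
  ... | inj₂ q≡l = ⊥-elim (q≢l q≡l)
  from : ∀ q → q ∈ₕ x₀ × q ≢ l → q ∈ₕ x × q ≢ l
  from q (q∈x₀ , q≢l) = proj₂ (cx q) (inj₁ q∈x₀) , q≢l

delete-other : ∀ {x x₀ y l z d} → y ≢ l → Codes x (λ q → q ∈ₕ x₀ ⊎ q ≡ y) →
  Codes z (λ q → q ∈ₕ x × q ≢ l) → Codes d (λ q → q ∈ₕ x₀ × q ≢ l) → Codes z (λ q → q ∈ₕ d ⊎ q ≡ y)
delete-other {x} {x₀} {y} {l} {z} {d} y≢l cx cz cd q = to , from
  where
  to : q ∈ₕ z → q ∈ₕ d ⊎ q ≡ y
  to q∈z with proj₁ (cz q) q∈z
  ... | q∈x , q≢l with proj₁ (cx q) q∈x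
  ...   | inj₁ q∈x₀ = inj₁ (proj₂ (cd q) (q∈x₀ , q≢l))
  ...   | inj₂ q≡y = inj₂ q≡y
  from : q ∈ₕ d ⊎ q ≡ y → q ∈ₕ z
  from (inj₁ q∈d) with proj₁ (cd q) q∈d
  ... | q∈x₀ , q≢l = proj₂ (cz q) (proj₂ (cx q) (inj₁ q∈x₀) , q≢l)
  from (inj₂ refl) = proj₂ (cz q) (proj₂ (cx q) (inj₂ refl) , y≢l)

-- The hierarchy A_n

-- A_{n-1} as a list (empty for n = 0).
A-prev : ℕ → List ℕ
A-prev n = A (pred (+ n))

A-suc-cases : ∀ n x → x ∈ A′ (suc n) →
  x ≡ 0 ⊎ Σ ℕ λ x₀ → Σ ℕ λ y → x₀ ∈ A′ n × y ∈ A′ n × x ≡ adj x₀ y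
A-suc-cases n x x∈ with ∈-deduplicate⁻ _≟_ (0 ∷ concatMap (λ x₀ → map (adj x₀) (A′ n)) (A′ n)) x∈
... | here x≡0 = inj₁ x≡0
... | there x∈adj with find (∈-concatMap⁻ (λ x₀ → map (adj x₀) (A′ n)) {xs = A′ n} x∈adj)
...   | x₀ , x₀∈ , x∈map with ∈-map⁻ (adj x₀) x∈map
...     | y , y∈ , x≡ = inj₂ (x₀ , y , x₀∈ , y∈ , x≡)

∅∈A : ∀ n → 0 ∈ A′ n
∅∈A zero = here refl
∅∈A (suc n) = ∈-deduplicate⁺ _≟_ {xs = 0 ∷ concatMap (λ x → map (adj x) (A′ n)) (A′ n)} (here refl)

adj∈A : ∀ n {x₀ y} → x₀ ∈ A′ n → y ∈ A′ n → adj x₀ y ∈ A′ (suc n)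
adj∈A n {x₀} {y} x₀∈ y∈ = ∈-deduplicate⁺ _≟_ {xs = 0 ∷ concatMap (λ x → map (adj x) (A′ n)) (A′ n)}
  (there (∈-concatMap⁺ (λ x → map (adj x) (A′ n))
    (lose {P = λ x → adj x₀ y ∈ map (adj x) (A′ n)} x₀∈ (∈-map⁺ (adj x₀) y∈))))

A-step : ∀ n {x} → x ∈ A′ n → x ∈ A′ (suc n)
A-step zero (here refl) = ∅∈A 1
A-step (suc n) x∈ with A-suc-cases n _ x∈
... | inj₁ refl = ∅∈A (suc (suc n))
... | inj₂ (x₀ , y , x₀∈ , y∈ , refl) = adj∈A (suc n) (A-step n x₀∈) (A-step n y∈)

A-mono : ∀ {n k x} → n ≤ k → x ∈ A′ n → x ∈ A′ k
A-mono {k = zero} z≤n x∈ = x∈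
A-mono {k = suc k} n≤ x∈ with m≤n⇒m<n∨m≡n n≤
... | inj₁ n<1+k = A-step k (A-mono (≤-pred n<1+k) x∈)
... | inj₂ refl = x∈

A-prev⊆A : ∀ n {z} → z ∈ A-prev n → z ∈ A′ n
A-prev⊆A (suc n) = A-step n

A-members : ∀ n {x q} → x ∈ A′ n → q ∈ₕ x → q ∈ A-prev n
A-members zero {q = q} (here refl) q∈x = ⊥-elim (∉∅ q q∈x)
A-members (suc n) {q = q} x∈ q∈x with A-suc-cases n _ x∈
... | inj₁ refl = ⊥-elim (∉∅ q q∈x)
... | inj₂ (x₀ , y , x₀∈ , y∈ , refl) with proj₁ (adj-codes x₀ y q) q∈x
...   | inj₁ q∈x₀ = A-prev⊆A n (A-members n x₀∈ q∈x₀)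
...   | inj₂ refl = y∈

A-unique : ∀ n → Unique (A′ n)
A-unique zero = [] ∷ []
A-unique (suc n) = deduplicate-! (0 ∷ concatMap (λ x → map (adj x) (A′ n)) (A′ n))

A-prev-unique : ∀ n → Unique (A-prev n)
A-prev-unique zero = []
A-prev-unique (suc n) = A-unique n

level-bound : ∀ m {l j} → ¬ l ∈ A-prev m → l ∈ A′ j → m ≤ j
level-bound zero _ _ = z≤n
level-bound (suc m) {j = j} l∉ l∈ with m <? j
... | yes m<j = m<j
... | no m≮j = ⊥-elim (l∉ (A-mono (≮⇒≥ m≮j) l∈))

level-above : ∀ m {l w j} → ¬ l ∈ A-prev m → l ∈ₕ w → w ∈ A′ j → Σ ℕ λ j' → j ≡ suc j' × m ≤ j'
level-above m {l} {j = zero} _ l∈w (here refl) = ⊥-elim (∉∅ l l∈w)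
level-above m {j = suc j} l∉ l∈w w∈ = j , refl , level-bound m l∉ (A-members (suc j) w∈ l∈w)

-- The level shift

insert-closed : ∀ j {z l w} → z ∈ A′ j → l ∈ A′ j → Codes w (λ q → q ∈ₕ z ⊎ q ≡ l) → w ∈ A′ (suc j)
insert-closed j {z} {l} z∈ l∈ cw =
  subst (_∈ A′ (suc j)) (codes-ext (adj-codes z l) cw (λ _ p → p) (λ _ p → p)) (adj∈A j z∈ l∈)

delete-from-∅ : ∀ {l z} → Codes z (λ q → q ∈ₕ 0 × q ≢ l) → z ≡ 0
delete-from-∅ cz = no-members⇒∅ λ q q∈z → ∉∅ q (proj₁ (proj₁ (cz q) q∈z))

-- Each A_j is closed under deleting an element (induction on j, writing
-- x = x₀ ∪ {y}:  x ∖ {l} is x₀ ∖ {l} if y = l and (x₀ ∖ {l}) ∪ {y} otherwise).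
delete-closed : ∀ j {x l z} → x ∈ A′ j → Codes z (λ q → q ∈ₕ x × q ≢ l) → z ∈ A′ j
delete-closed zero (here refl) cz = subst (_∈ A′ 0) (sym (delete-from-∅ cz)) (here refl)
delete-closed (suc j) {x} {l} x∈ cz with A-suc-cases j x x∈
... | inj₁ refl = subst (_∈ A′ (suc j)) (sym (delete-from-∅ cz)) (∅∈A (suc j))
... | inj₂ (x₀ , y , x₀∈ , y∈ , refl) with delete-codes x₀ l | y ≟ l
...   | d , cd | yes refl =
  subst (_∈ A′ (suc j)) (sym (delete-adjoined (adj-codes x₀ y) cz cd)) (A-step j (delete-closed j x₀∈ cd))
...   | d , cd | no y≢l = insert-closed j (delete-closed j x₀∈ cd) y∈ (delete-other y≢l (adj-codes x₀ y) cz cd)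

-- Write w = x₀ ∪ {y} with x₀, y ∈ A_j.  If y = l, then w ∖ {l} = x₀ ∖ {l} ∈ A_j.
-- Otherwise l ∈ x₀ forces j = j' + 1 with m ≤ j', so by induction x₀ ∖ {l} ∈ A_j',
-- and y ∈ A_m ⊆ A_j' gives w ∖ {l} = (x₀ ∖ {l}) ∪ {y} ∈ A_j.
strip-new : ∀ m {l} → ¬ l ∈ A-prev m → ∀ j {w z} → w ∈ A′ (suc j) → l ∈ₕ w →
  (∀ q → q ∈ₕ z → q ∈ A′ m) → Codes z (λ q → q ∈ₕ w × q ≢ l) → z ∈ A′ j
strip-new m {l} l∉prev j {w} {z} w∈ l∈w z⊆ cz with A-suc-cases j w w∈
... | inj₁ refl = ⊥-elim (∉∅ l l∈w)
... | inj₂ (x₀ , y , x₀∈ , y∈ , refl) with delete-codes x₀ l | y ≟ l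
...   | d , cd | yes refl = subst (_∈ A′ j) (sym (delete-adjoined (adj-codes x₀ y) cz cd)) (delete-closed j x₀∈ cd)
...   | d , cd | no y≢l with proj₁ (adj-codes x₀ y l) l∈w
...     | inj₂ l≡y = ⊥-elim (y≢l (sym l≡y))
...     | inj₁ l∈x₀ with level-above m {l} {x₀} {j} l∉prev l∈x₀ x₀∈
...       | j' , refl , m≤j' = insert-closed j' d∈ y∈A′ z=d∪y
  where
  z=d∪y : Codes z (λ q → q ∈ₕ d ⊎ q ≡ y)
  z=d∪y = delete-other y≢l (adj-codes x₀ y) cz cd
  d∈ : d ∈ A′ j'
  d∈ = strip-new m l∉prev j' x₀∈ l∈x₀ (λ q q∈d → z⊆ q (proj₂ (z=d∪y q) (inj₁ q∈d))) cd
  y∈A′ : y ∈ A′ j'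
  y∈A′ = A-mono m≤j' (z⊆ y (proj₂ (z=d∪y y) (inj₂ refl)))

adjoin-new-level : ∀ m {l z w j} → ¬ l ∈ A-prev m → (∀ q → q ∈ₕ z → q ∈ A′ m) → ¬ l ∈ₕ z →
  Codes w (λ q → q ∈ₕ z ⊎ q ≡ l) → w ∈ A′ j → Σ ℕ λ j' → j ≡ suc j' × m ≤ j' × z ∈ A′ j'
adjoin-new-level m {l} {z} {w} {j} l∉prev z⊆ l∉z cw w∈
  with level-above m {l} {w} {j} l∉prev (proj₂ (cw l) (inj₂ refl)) w∈
... | j' , refl , m≤j' =
  j' , refl , m≤j' , strip-new m l∉prev j' w∈ (proj₂ (cw l) (inj₂ refl)) z⊆ (insert-then-delete l∉z cw)

-- Counting in duplicate-free lists

count : {P : Pred ℕ 0ℓ} → Decidable P → List ℕ → ℕ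
count P? xs = length (filter P? xs)

unique-set-length : ∀ {xs ys : List ℕ} → Unique xs → Unique ys →
  (∀ {z} → z ∈ xs → z ∈ ys) → (∀ {z} → z ∈ ys → z ∈ xs) → length xs ≡ length ys
unique-set-length u v xs⊆ys ys⊆xs = ↭-length (∼bag⇒↭ (unique∧set⇒bag u v (mk⇔ xs⊆ys ys⊆xs)))

module _ {P : Pred ℕ 0ℓ} (P? : Decidable P) where

  count≡length : ∀ {xs ys} → Unique xs → Unique ys →
    (∀ {z} → z ∈ xs → P z → z ∈ ys) → (∀ {z} → z ∈ ys → z ∈ xs × P z) → count P? xs ≡ length ys
  count≡length u v to from = unique-set-length (Unique.filter⁺ P? u) v
    (λ z∈ → let z∈xs , Pz = ∈-filter⁻ P? z∈ in to z∈xs Pz)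
    (λ z∈ → let z∈xs , Pz = from z∈ in ∈-filter⁺ P? z∈xs Pz)

  count-transfer : ∀ {Q : Pred ℕ 0ℓ} (Q? : Decidable Q) {xs ys} → Unique xs → Unique ys →
    (∀ {z} → z ∈ xs → P z → z ∈ ys × Q z) → (∀ {z} → z ∈ ys → Q z → z ∈ xs × P z) →
    count P? xs ≡ count Q? ys
  count-transfer Q? u v to from = count≡length u (Unique.filter⁺ Q? v)
    (λ z∈ Pz → let z∈ys , Qz = to z∈ Pz in ∈-filter⁺ Q? z∈ys Qz)
    (λ z∈ → let z∈ys , Qz = ∈-filter⁻ Q? z∈ in from z∈ys Qz)

  count-++ : ∀ xs ys → count P? (xs ++ ys) ≡ count P? xs + count P? ys
  count-++ xs ys = trans (cong length (filter-++ P? xs ys)) (length-++ (filter P? xs))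

  count-map : ∀ (f : ℕ → ℕ) xs → count P? (map f xs) ≡ count (λ z → P? (f z)) xs
  count-map f [] = refl
  count-map f (x ∷ xs) with P? (f x)
  ... | yes _ = cong suc (count-map f xs)
  ... | no _ = count-map f xs

-- The list of all subsets of a list

-- codes of all subsets of U (for U duplicate-free)
subsets : List ℕ → List ℕ
subsets [] = 0 ∷ []
subsets (u ∷ U) = subsets U ++ map (λ s → s + 2 ^ u) (subsets U)

head-fresh : ∀ {u : ℕ} {U : List ℕ} → Unique (u ∷ U) → ¬ u ∈ U
head-fresh (u∉U ∷ _) = All¬⇒¬Any u∉U

subsets-members : ∀ U → Unique U → ∀ {z q} → z ∈ subsets U → q ∈ₕ z → q ∈ U
subsets-members [] _ {q = q} (here refl) q∈z = ⊥-elim (∉∅ q q∈z)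
subsets-members (u ∷ U) uU@(_ ∷ U-unique) {q = q} z∈ q∈z with ∈-++⁻ (subsets U) z∈
... | inj₁ z∈U = there (subsets-members U U-unique z∈U q∈z)
... | inj₂ z∈shifted with ∈-map⁻ (λ s → s + 2 ^ u) z∈shifted
...   | s , s∈ , refl with proj₁ (insert-codes s u (head-fresh uU ∘ subsets-members U U-unique s∈) q) q∈z
...     | inj₁ q∈s = there (subsets-members U U-unique s∈ q∈s)
...     | inj₂ refl = here refl

subsets-complete : ∀ U {z} → (∀ q → q ∈ₕ z → q ∈ U) → z ∈ subsets U
subsets-complete [] z⊆ = here (no-members⇒∅ λ q q∈z → no-member (z⊆ q q∈z))
  where
  no-member : ∀ {q} → ¬ q ∈ []
  no-member ()
subsets-complete (u ∷ U) {z} z⊆ with u ∈ₕ? z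
... | no u∉z = ∈-++⁺ˡ (subsets-complete U λ q q∈z → tail (λ { refl → u∉z q∈z }) (z⊆ q q∈z))
... | yes u∈z with clear-bit u z u∈z
...   | z' , clear , refl = ∈-++⁺ʳ (subsets U) (∈-map⁺ (λ s → s + 2 ^ u) (subsets-complete U z'⊆))
  where
  z'⊆ : ∀ q → q ∈ₕ z' → q ∈ U
  z'⊆ q q∈z' = tail (λ { refl → clear⇒∉ u z' clear q∈z' })
    (z⊆ q (proj₂ (insert-codes z' u (clear⇒∉ u z' clear) q) (inj₁ q∈z')))

-- ... and no subset is listed twice: the shifted copies all contain u, the others do not.
subsets-unique : ∀ U → Unique U → Unique (subsets U)
subsets-unique [] _ = [] ∷ []
subsets-unique (u ∷ U) uU@(_ ∷ U-unique) =
  Unique.++⁺ sub-unique (Unique.map⁺ (λ {x} {y} → +-cancelʳ-≡ (2 ^ u) x y) sub-unique) disjoint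
  where
  sub-unique : Unique (subsets U)
  sub-unique = subsets-unique U U-unique
  disjoint : ∀ {v} → ¬ (v ∈ subsets U × v ∈ map (λ s → s + 2 ^ u) (subsets U))
  disjoint (v∈ , v∈shifted) with ∈-map⁻ (λ s → s + 2 ^ u) v∈shifted
  ... | s , s∈ , refl = head-fresh uU (subsets-members U U-unique v∈
    (proj₂ (insert-codes s u (head-fresh uU ∘ subsets-members U U-unique s∈) u) (inj₂ refl)))

count-subsets-∷ : ∀ {P : Pred ℕ 0ℓ} (P? : Decidable P) u U →
  count P? (subsets (u ∷ U)) ≡ count P? (subsets U) + count (λ z → P? (z + 2 ^ u)) (subsets U)
count-subsets-∷ P? u U = trans (count-++ P? (subsets U) _)
  (cong (λ t → count P? (subsets U) + t) (count-map P? (λ s → s + 2 ^ u) (subsets U)))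

-- The numbers b_{n,S} as counts of subsets

⊆⇒AllBelow : ∀ k {x S} → (∀ q → q ∈ₕ x → q ∈ S) → AllBelow k x S
⊆⇒AllBelow zero _ = tt
⊆⇒AllBelow (suc k) x⊆ = ⊆⇒AllBelow k x⊆ , x⊆ k

AllBelow⇒⊆-below : ∀ k {x S q} → AllBelow k x S → q < k → q ∈ₕ x → q ∈ S
AllBelow⇒⊆-below (suc k) {q = q} (below , at-k) q<1+k q∈x with q ≟ k
... | yes refl = at-k q∈x
... | no q≢k = AllBelow⇒⊆-below k below (≤∧≢⇒< (≤-pred q<1+k) q≢k) q∈x

AllBelow⇒⊆ : ∀ {x S} → AllBelow x x S → ∀ q → q ∈ₕ x → q ∈ S
AllBelow⇒⊆ {x} below q q∈x = AllBelow⇒⊆-below x below (member-< q x q∈x) q∈x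

Exact : ℕ → ℕ → Set
Exact n z = z ∈ A′ n × ¬ z ∈ A-prev n

exact? : ∀ n → Decidable (Exact n)
exact? n z = (z ∈? A′ n) ×-dec ¬? (z ∈? A-prev n)

new-within? : ∀ n S → Decidable (λ x → ¬ x ∈ A-prev n × AllBelow x x S)
new-within? n S x = ¬? (x ∈? A-prev n) ×-dec (x ⊆ₕ? S)

count-new-within : ∀ n {S T} → Unique T → (∀ {q} → q ∈ S → q ∈ T) → (∀ {q} → q ∈ T → q ∈ S) →
  count (new-within? n S) (A′ n) ≡ count (exact? n) (subsets T)
count-new-within n {S} {T} T-unique S⊆T T⊆S =
  count-transfer (new-within? n S) (exact? n) (A-unique n) (subsets-unique T T-unique)
  (λ {z} z∈ (new , z⊆S) → subsets-complete T (λ q q∈z → S⊆T (AllBelow⇒⊆ z⊆S q q∈z)) , z∈ , new)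
  (λ {z} z∈ (z∈A , new) → z∈A , new , ⊆⇒AllBelow z (λ q q∈z → T⊆S (subsets-members T T-unique z∈ q∈z)))

-- Finite sums and the Pascal recurrence

Σ< : (ℕ → ℕ) → ℕ → ℕ
Σ< f n = sum (applyUpTo f n)

Σ<-last : ∀ f n → Σ< f (suc n) ≡ Σ< f n + f n
Σ<-last f n = begin
  sum (applyUpTo f (suc n))              ≡⟨ cong sum (applyUpTo-∷ʳ f n) ⟨
  sum (applyUpTo f n ++ [ f n ])         ≡⟨ sum-++ (applyUpTo f n) [ f n ] ⟩
  Σ< f n + (f n + 0)                     ≡⟨ cong (λ t → Σ< f n + t) (+-identityʳ (f n)) ⟩
  Σ< f n + f n                           ∎
  where open ≡-Reasoning

Σ<-cong : ∀ f g n → (∀ i → i < n → f i ≡ g i) → Σ< f n ≡ Σ< g n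
Σ<-cong f g zero _ = refl
Σ<-cong f g (suc n) f≡g =
  cong₂ _+_ (f≡g 0 (s≤s z≤n)) (Σ<-cong (f ∘ suc) (g ∘ suc) n λ i i<n → f≡g (suc i) (s≤s i<n))

Σ<-+ : ∀ f g n → Σ< (λ i → f i + g i) n ≡ Σ< f n + Σ< g n
Σ<-+ f g zero = refl
Σ<-+ f g (suc n) =
  trans (cong (λ t → f 0 + g 0 + t) (Σ<-+ (f ∘ suc) (g ∘ suc) n)) (interchange (f 0) (g 0) _ _)
  where
  open +-*-Solver
  interchange : ∀ a b c d → a + b + (c + d) ≡ a + c + (b + d)
  interchange = solve 4 (λ a b c d → (a :+ b) :+ (c :+ d) := (a :+ c) :+ (b :+ d)) refl

Σ<-zero : ∀ f n → (∀ i → f i ≡ 0) → Σ< f n ≡ 0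
Σ<-zero f zero _ = refl
Σ<-zero f (suc n) f≡0 = cong₂ _+_ (f≡0 0) (Σ<-zero (f ∘ suc) n (f≡0 ∘ suc))

-- For arbitrary β and E, the function
--     F c r = β r + Σ_{1 ≤ k ≤ r} β (r - k) · C(c, k) + C(c, r + 1) · E
-- satisfies  F 0 r = β r,  F (c+1) 0 = F c 0 + E  and
-- F (c+1) (r+1) = F c (r+1) + F c r;  these are the recurrences of the counts below.
module Pascal (β : ℕ → ℕ) (E : ℕ) where

  T : ℕ → ℕ → ℕ
  T c r = Σ< (λ i → β (r ∸ suc i) * (c C suc i)) r

  F : ℕ → ℕ → ℕ
  F c r = β r + T c r + (c C suc r) * E

  F-empty : ∀ r → F 0 r ≡ β r
  F-empty r = begin
    β r + T 0 r + 0 ≡⟨ +-identityʳ _ ⟩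
    β r + T 0 r     ≡⟨ cong (λ t → β r + t) (Σ<-zero _ r (λ i → *-zeroʳ (β (r ∸ suc i)))) ⟩
    β r + 0         ≡⟨ +-identityʳ (β r) ⟩
    β r             ∎
    where open ≡-Reasoning

  -- Pascal's rule C(c+1, k+1) = C(c, k+1) + C(c, k), summed against β.
  T-pascal : ∀ c r → T (suc c) (suc r) ≡ T c (suc r) + (β r + T c r)
  T-pascal c r = begin
    T (suc c) (suc r)
      ≡⟨ Σ<-cong _ _ (suc r) (λ i _ → pascal i) ⟩
    Σ< (λ i → β (r ∸ i) * (c C suc i) + β (r ∸ i) * (c C i)) (suc r)
      ≡⟨ Σ<-+ (λ i → β (r ∸ i) * (c C suc i)) (λ i → β (r ∸ i) * (c C i)) (suc r) ⟩
    T c (suc r) + (β r * 1 + T c r)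
      ≡⟨ cong (λ t → T c (suc r) + (t + T c r)) (*-identityʳ (β r)) ⟩
    T c (suc r) + (β r + T c r) ∎
    where
    open ≡-Reasoning
    pascal : ∀ i → β (r ∸ i) * (suc c C suc i) ≡ β (r ∸ i) * (c C suc i) + β (r ∸ i) * (c C i)
    pascal i = begin
      β (r ∸ i) * (suc c C suc i)                      ≡⟨ cong (β (r ∸ i) *_) (nCk+nC[k+1]≡[n+1]C[k+1] c i) ⟨
      β (r ∸ i) * (c C i + c C suc i)                  ≡⟨ *-distribˡ-+ (β (r ∸ i)) (c C i) (c C suc i) ⟩
      β (r ∸ i) * (c C i) + β (r ∸ i) * (c C suc i)    ≡⟨ +-comm (β (r ∸ i) * (c C i)) _ ⟩
      β (r ∸ i) * (c C suc i) + β (r ∸ i) * (c C i)    ∎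

  F-step-zero : ∀ c → F (suc c) 0 ≡ F c 0 + E
  F-step-zero c = begin
    β 0 + 0 + (suc c C 1) * E ≡⟨ cong (λ t → β 0 + 0 + t * E) (nC1≡n (suc c)) ⟩
    β 0 + 0 + suc c * E       ≡⟨ regroup (β 0) c E ⟩
    β 0 + 0 + c * E + E       ≡⟨ cong (λ t → β 0 + 0 + t * E + E) (nC1≡n c) ⟨
    β 0 + 0 + (c C 1) * E + E ∎
    where
    open ≡-Reasoning
    open +-*-Solver
    regroup : ∀ b c e → b + 0 + suc c * e ≡ b + 0 + c * e + e
    regroup = solve 3 (λ b c e → b :+ con 0 :+ (con 1 :+ c) :* e := b :+ con 0 :+ c :* e :+ e) refl

  F-step : ∀ c r → F (suc c) (suc r) ≡ F c (suc r) + F c r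
  F-step c r = begin
    β (suc r) + T (suc c) (suc r) + (suc c C suc (suc r)) * E
      ≡⟨ cong₂ (λ t k → β (suc r) + t + k * E) (sym (T-pascal c r)) (nCk+nC[k+1]≡[n+1]C[k+1] c (suc r)) ⟨
    β (suc r) + (T c (suc r) + (β r + T c r)) + (c C suc r + c C suc (suc r)) * E
      ≡⟨ regroup (β (suc r)) (T c (suc r)) (β r) (T c r) (c C suc r) (c C suc (suc r)) E ⟩
    β (suc r) + T c (suc r) + (c C suc (suc r)) * E + (β r + T c r + (c C suc r) * E) ∎
    where
    open ≡-Reasoning
    open +-*-Solver
    regroup : ∀ b₁ t₁ b₀ t₀ x y e → b₁ + (t₁ + (b₀ + t₀)) + (x + y) * e ≡ b₁ + t₁ + y * e + (b₀ + t₀ + x * e)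
    regroup = solve 7 (λ b₁ t₁ b₀ t₀ x y e →
      b₁ :+ (t₁ :+ (b₀ :+ t₀)) :+ (x :+ y) :* e := b₁ :+ t₁ :+ y :* e :+ (b₀ :+ t₀ :+ x :* e)) refl

-- Counting the subsets of A_m by exact level

r+[1+m]∸m≡1+r : ∀ r m → r + suc m ∸ m ≡ suc r
r+[1+m]∸m≡1+r r m = trans (cong (_∸ m) (+-suc r m)) (m+n∸n≡m (suc r) m)

module LevelCount (m : ℕ) where

  U : List ℕ
  U = A-prev m

  L : List ℕ
  L = B (+ m) (pred (+ m))

  L-new : ∀ {l} → l ∈ L → l ∈ A′ m × ¬ l ∈ U
  L-new l∈ with ∈-filter⁻ (new-within? m U) {xs = A′ m} l∈
  ... | l∈A , l∉U , _ = l∈A , l∉U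

  L++U-unique : Unique (L ++ U)
  L++U-unique = Unique.++⁺ (Unique.filter⁺ (new-within? m U) (A-unique m)) (A-prev-unique m)
    λ (l∈L , l∈U) → proj₂ (L-new l∈L) l∈U

  A⊆L++U : ∀ {z} → z ∈ A′ m → z ∈ L ++ U
  A⊆L++U {z} z∈ with z ∈? U
  ... | yes z∈U = ∈-++⁺ʳ L z∈U
  ... | no z∉U = ∈-++⁺ˡ (∈-filter⁺ (new-within? m U) z∈ (z∉U , ⊆⇒AllBelow z (λ q → A-members m z∈)))

  L++U⊆A : ∀ {z} → z ∈ L ++ U → z ∈ A′ m
  L++U⊆A z∈ with ∈-++⁻ L z∈
  ... | inj₁ z∈L = proj₁ (L-new z∈L)
  ... | inj₂ z∈U = A-prev⊆A m z∈U

  size-A : length (A′ m) ≡ b (+ m) (pred (+ m)) + length U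
  size-A = trans (unique-set-length (A-unique m) L++U-unique A⊆L++U L++U⊆A) (length-++ L)

  Fresh : List ℕ → Set
  Fresh K = Unique (K ++ U) × (∀ {l} → l ∈ K → l ∈ A′ m × ¬ l ∈ U)

  fresh-L : Fresh L
  fresh-L = L++U-unique , L-new

  N : List ℕ → ℕ → ℕ
  N K n = count (exact? n) (subsets (K ++ U))

  subset-members-in-A : ∀ {K z q} → Fresh K → z ∈ subsets (K ++ U) → q ∈ₕ z → q ∈ A′ m
  subset-members-in-A {K} (K++U-unique , K-new) z∈ q∈z
    with ∈-++⁻ K (subsets-members (K ++ U) K++U-unique z∈ q∈z)
  ... | inj₁ q∈K = proj₁ (K-new q∈K)
  ... | inj₂ q∈U = A-prev⊆A m q∈U

  module Adjoin {l : ℕ} {K : List ℕ} (fresh : Fresh (l ∷ K)) where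

    fresh-K : Fresh K
    fresh-K = unique-tail (proj₁ fresh) , proj₂ fresh ∘ there

    S : List ℕ
    S = subsets (K ++ U)

    S-unique : Unique S
    S-unique = subsets-unique (K ++ U) (proj₁ fresh-K)

    l∉z : ∀ {z} → z ∈ S → ¬ l ∈ₕ z
    l∉z z∈ l∈z = head-fresh (proj₁ fresh) (subsets-members (K ++ U) (proj₁ fresh-K) z∈ l∈z)

    z∪l : ∀ {z} → z ∈ S → Codes (z + 2 ^ l) (λ q → q ∈ₕ z ⊎ q ≡ l)
    z∪l {z} z∈ = insert-codes z l (l∉z z∈)

    level-up : ∀ {z j} → z ∈ S → z + 2 ^ l ∈ A′ j → Σ ℕ λ j' → j ≡ suc j' × m ≤ j' × z ∈ A′ j'
    level-up {z} {j} z∈ = adjoin-new-level m {l} {z} {z + 2 ^ l} {j} (proj₂ (proj₂ fresh (here refl)))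
      (λ q → subset-members-in-A fresh-K z∈) (l∉z z∈) (z∪l z∈)

    level-down : ∀ {z j} → z ∈ S → m ≤ j → z ∈ A′ j → z + 2 ^ l ∈ A′ (suc j)
    level-down {j = j} z∈ m≤j z∈A =
      insert-closed j z∈A (A-mono m≤j (proj₁ (proj₂ fresh (here refl)))) (z∪l z∈)

    -- Exactly the subsets lying in A_m move to exact level m + 1 ...
    count-at-m+1 : N (l ∷ K) (suc m) ≡ N K (suc m) + length (A′ m)
    count-at-m+1 = trans (count-subsets-∷ (exact? (suc m)) l (K ++ U)) (cong (λ t → N K (suc m) + t) moved)
      where
      to : ∀ {z} → z ∈ S → Exact (suc m) (z + 2 ^ l) → z ∈ A′ m
      to {z} z∈ (w∈ , _) with level-up {z} {suc m} z∈ w∈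
      ... | _ , refl , _ , z∈A = z∈A
      from : ∀ {z} → z ∈ A′ m → z ∈ S × Exact (suc m) (z + 2 ^ l)
      from {z} z∈A = z∈ , level-down z∈ ≤-refl z∈A , not-lower
        where
        z∈ : z ∈ S
        z∈ = subsets-complete (K ++ U) (λ q q∈z → ∈-++⁺ʳ K (A-members m z∈A q∈z))
        not-lower : ¬ z + 2 ^ l ∈ A′ m
        not-lower w∈ with level-up {z} {m} z∈ w∈
        ... | _ , refl , m≤j' , _ = 1+n≰n m≤j'
      moved : count (λ z → exact? (suc m) (z + 2 ^ l)) S ≡ length (A′ m)
      moved = count≡length (λ z → exact? (suc m) (z + 2 ^ l)) S-unique (A-unique m) to from

    -- ... and above level m + 1 the exact level of every subset goes up by one.
    count-above : ∀ {j} → m < j → N (l ∷ K) (suc j) ≡ N K (suc j) + N K j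
    count-above {suc j} (s≤s m≤j) =
      trans (count-subsets-∷ (exact? (suc (suc j))) l (K ++ U)) (cong (λ t → N K (suc (suc j)) + t) shifted)
      where
      to : ∀ {z} → z ∈ S → Exact (suc (suc j)) (z + 2 ^ l) → z ∈ S × Exact (suc j) z
      to {z} z∈ (w∈ , w∉) with level-up {z} {suc (suc j)} z∈ w∈
      ... | _ , refl , _ , z∈A = z∈ , z∈A , λ z∈A-prev → w∉ (level-down z∈ m≤j z∈A-prev)
      from : ∀ {z} → z ∈ S → Exact (suc j) z → z ∈ S × Exact (suc (suc j)) (z + 2 ^ l)
      from {z} z∈ (z∈A , z∉A-prev) = z∈ , level-down z∈ (m≤n⇒m≤1+n m≤j) z∈A , not-lower
        where
        not-lower : ¬ z + 2 ^ l ∈ A′ (suc j)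
        not-lower w∈ with level-up {z} {suc j} z∈ w∈
        ... | _ , refl , _ , z∈A-prev = z∉A-prev z∈A-prev
      shifted : count (λ z → exact? (suc (suc j)) (z + 2 ^ l)) S ≡ N K (suc j)
      shifted =
        count-transfer (λ z → exact? (suc (suc j)) (z + 2 ^ l)) (exact? (suc j)) S-unique S-unique to from

  β : ℕ → ℕ
  β r = b (+ (r + suc m)) (pred (+ m))

  open Pascal β (length (A′ m)) public

  N-empty : ∀ n → N [] n ≡ b (+ n) (pred (+ m))
  N-empty n = sym (count-new-within n (A-prev-unique m) (λ q∈ → q∈) (λ q∈ → q∈))

  level-count : ∀ K → Fresh K → ∀ r → N K (r + suc m) ≡ F (length K) r
  level-count [] _ r = trans (N-empty (r + suc m)) (sym (F-empty r))
  level-count (l ∷ K) fresh zero = begin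
    N (l ∷ K) (suc m)               ≡⟨ count-at-m+1 ⟩
    N K (suc m) + length (A′ m)     ≡⟨ cong (λ t → t + length (A′ m)) (level-count K fresh-K zero) ⟩
    F (length K) 0 + length (A′ m)  ≡⟨ F-step-zero (length K) ⟨
    F (suc (length K)) 0            ∎
    where
    open ≡-Reasoning
    open Adjoin fresh
  level-count (l ∷ K) fresh (suc r) = begin
    N (l ∷ K) (suc (r + suc m))              ≡⟨ count-above (m≤n+m (suc m) r) ⟩
    N K (suc (r + suc m)) + N K (r + suc m)  ≡⟨ cong₂ _+_ (level-count K fresh-K (suc r)) (level-count K fresh-K r) ⟩
    F (length K) (suc r) + F (length K) r    ≡⟨ F-step (length K) r ⟨
    F (suc (length K)) (suc r)               ∎
    where
    open ≡-Reasoning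
    open Adjoin fresh

  -- The sum in the theorem is T, re-indexed by k = i + 1.
  T-as-sum : ∀ c r →
    T c r ≡ sum (map (λ k → b (+ (r + suc m ∸ k)) (pred (+ m)) * (c C k)) (map suc (upTo (r + suc m ∸ m ∸ 1))))
  T-as-sum c r = begin
    T c r                           ≡⟨ Σ<-cong _ (f ∘ suc) r reindex ⟩
    Σ< (f ∘ suc) r                  ≡⟨ cong sum (map-applyUpTo suc f r) ⟨
    sum (map f (applyUpTo suc r))   ≡⟨ cong (λ ks → sum (map f ks)) (map-applyUpTo id suc r) ⟨
    sum (map f (map suc (upTo r)))  ≡⟨ cong (λ t → sum (map f (map suc (upTo (t ∸ 1))))) (r+[1+m]∸m≡1+r r m) ⟨
    sum (map f (map suc (upTo (r + suc m ∸ m ∸ 1)))) ∎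
    where
    open ≡-Reasoning
    f : ℕ → ℕ
    f k = b (+ (r + suc m ∸ k)) (pred (+ m)) * (c C k)
    reindex : ∀ i → i < r → β (r ∸ suc i) * (c C suc i) ≡ f (suc i)
    reindex i i<r = cong (λ n → b (+ n) (pred (+ m)) * (c C suc i)) (sym (+-∸-comm (suc m) i<r))

size-A-sum : ∀ m → Σ< (λ k → b (+ k) (pred (+ k))) (suc m) ≡ length (A′ m)
size-A-sum zero = sym (LevelCount.size-A 0)
size-A-sum (suc m) = begin
  Σ< g (suc (suc m))         ≡⟨ Σ<-last g (suc m) ⟩
  Σ< g (suc m) + g (suc m)   ≡⟨ cong (λ t → t + g (suc m)) (size-A-sum m) ⟩
  length (A′ m) + g (suc m)  ≡⟨ +-comm (length (A′ m)) (g (suc m)) ⟩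
  g (suc m) + length (A′ m)  ≡⟨ LevelCount.size-A (suc m) ⟨
  length (A′ (suc m))        ∎
  where
  open ≡-Reasoning
  g : ℕ → ℕ
  g k = b (+ k) (pred (+ k))

above : ∀ {m n} → m < n → Σ ℕ λ r → r + suc m ≡ n
above m<n = _ , m∸n+n≡m m<n

-- With n = r + m + 1, b_{n,m} counts the subsets of L ∪ U = A_m at exact level n.
-- By the Pascal recurrence this is F(|L|, r) = β r + T c r + C(c, r+1) |A_m|
-- with c = |L| = b_{m,m-1}; it remains to rewrite T and |A_m| as the sums of the statement.
theorem1 : (n m : ℕ) → m < n →
    b (+ n) (+ m)
      ≡ b (+ n) (pred (+ m))
        + sum (map (λ k → b (+ (n ∸ k)) (pred (+ m)) * (b (+ m) (pred (+ m)) C k))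
                   (map suc (upTo (n ∸ m ∸ 1))))
        + (b (+ m) (pred (+ m)) C (n ∸ m))
          * sum (map (λ k → b (+ k) (pred (+ k))) (upTo (suc m)))
theorem1 n m m<n with above m<n
... | r , refl = begin
  b (+ (r + suc m)) (+ m)  ≡⟨ count-new-within (r + suc m) L++U-unique A⊆L++U L++U⊆A ⟩
  N L (r + suc m)          ≡⟨ level-count L fresh-L r ⟩
  F c r                    ≡⟨ cong₂ (λ t e → β r + t + e) (T-as-sum c r) (cong₂ _*_ binomial-index E≡sum) ⟩
  _                        ∎
  where
  open ≡-Reasoning
  open LevelCount m
  c : ℕ
  c = b (+ m) (pred (+ m))
  binomial-index : c C suc r ≡ c C (r + suc m ∸ m)
  binomial-index = cong (c C_) (sym (r+[1+m]∸m≡1+r r m))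
  E≡sum : length (A′ m) ≡ sum (map (λ k → b (+ k) (pred (+ k))) (upTo (suc m)))
  E≡sum = trans (sym (size-A-sum m)) (cong sum (sym (map-applyUpTo id (λ k → b (+ k) (pred (+ k))) (suc m))))
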